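{- For all behaviours B1, B2 and B: if B1 [V] B2 == B, then B [>>] B1.
   Context: Behaviours of the process language SP are given by the grammar B ::= End | p!e @! a; B | p?x @? a; B | p(+)l @+ a; B | p & mB1 // mB2 | If e Then B1 Else B2 | Call X, with mB ::= None | Some (a,B) and labels l in {left, right}; in the branching term p & mB1 // mB2, mB1 is the (optional, annotated) behaviour offered for label left and mB2 the one for label right. The merge relation B1 [V] B2 == B (merge B1 B2 B) is defined inductively: End [V] End == End; Call X [V] Call X == Call X; two send terms (resp. receive, selection terms) with identical prefix merge to that prefix followed by the merge of their continuations; two conditionals with the same guard merge branchwise; two branching terms on the same process p merge label by label: if both offer a label (with the same annotation) the continuations are merged, if only one offers it that offer is kept, if neither offers it the result offers None. No other pairs are mergeable. The branching order B [>>] B' (more_branches) is defined inductively: End [>>] End; Call X [>>] Call X; congruence for send, receive and selection prefixes and for conditionals; and for branching terms p & mBl // mBr [>>] p & None // None, p & mBl // Some (a,Br) [>>] p & None // Some (a,Br') if Br [>>] Br', p & Some (a,Bl) // mBr [>>] p & Some (a,Bl') // None if Bl [>>] Bl', and p & Some (a,Bl) // Some (a',Br) [>>] p & Some (a,Bl') // Some (a',Br') if Bl [>>] Bl' and Br [>>] Br'. Intuitively, B [>>] B' means B offers at least the branches offered by B'. -}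

module Defs where

data Label : Set where
  left right : Label

-- The syntax of SP behaviours is parametric in the sets of
-- process names (P), expressions (E), variables (V),
-- annotations (A) and procedure names (X).
module SP (P E V A X : Set) where

  mutual
    data Behaviour : Set where
      End    : Behaviour
      Send   : P → E → A → Behaviour → Behaviour
      Recv   : P → V → A → Behaviour → Behaviour
      Sel    : P → Label → A → Behaviour → Behaviour
      Branch : P → MBehaviour → MBehaviour → Behaviour
      If     : E → Behaviour → Behaviour → Behaviour
      Call   : X → Behaviour

    data MBehaviour : Set where
      None : MBehaviour
      Some : A → Behaviour → MBehaviour

  mutual
    -- merge B1 B2 B   ( B1 [V] B2 == B )
    data merge : Behaviour → Behaviour → Behaviour → Set where
      m-End  : merge End End End
      m-Call : ∀ {x} → merge (Call x) (Call x) (Call x)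
      m-Send : ∀ {p e a B1 B2 B} → merge B1 B2 B →
               merge (Send p e a B1) (Send p e a B2) (Send p e a B)
      m-Recv : ∀ {p x a B1 B2 B} → merge B1 B2 B →
               merge (Recv p x a B1) (Recv p x a B2) (Recv p x a B)
      m-Sel  : ∀ {p l a B1 B2 B} → merge B1 B2 B →
               merge (Sel p l a B1) (Sel p l a B2) (Sel p l a B)
      m-If   : ∀ {e B1 B1' B2 B2' B B'} → merge B1 B2 B → merge B1' B2' B' →
               merge (If e B1 B1') (If e B2 B2') (If e B B')
      m-Branch : ∀ {p mBl1 mBr1 mBl2 mBr2 mBl mBr} →
               mmerge mBl1 mBl2 mBl → mmerge mBr1 mBr2 mBr →
               merge (Branch p mBl1 mBr1) (Branch p mBl2 mBr2) (Branch p mBl mBr)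

    data mmerge : MBehaviour → MBehaviour → MBehaviour → Set where
      mm-None  : mmerge None None None
      mm-Left  : ∀ {a B} → mmerge (Some a B) None (Some a B)
      mm-Right : ∀ {a B} → mmerge None (Some a B) (Some a B)
      mm-Both  : ∀ {a B1 B2 B} → merge B1 B2 B →
                 mmerge (Some a B1) (Some a B2) (Some a B)

  -- more_branches B B'   ( B [>>] B' )
  data more-branches : Behaviour → Behaviour → Set where
    mb-End  : more-branches End End
    mb-Call : ∀ {x} → more-branches (Call x) (Call x)
    mb-Send : ∀ {p e a B B'} → more-branches B B' →
              more-branches (Send p e a B) (Send p e a B')
    mb-Recv : ∀ {p x a B B'} → more-branches B B' →
              more-branches (Recv p x a B) (Recv p x a B')
    mb-Sel  : ∀ {p l a B B'} → more-branches B B' →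
              more-branches (Sel p l a B) (Sel p l a B')
    mb-If   : ∀ {e B1 B1' B2 B2'} → more-branches B1 B1' → more-branches B2 B2' →
              more-branches (If e B1 B2) (If e B1' B2')
    mb-None : ∀ {p mBl mBr} →
              more-branches (Branch p mBl mBr) (Branch p None None)
    mb-Right : ∀ {p mBl a Br Br'} → more-branches Br Br' →
              more-branches (Branch p mBl (Some a Br)) (Branch p None (Some a Br'))
    mb-Left : ∀ {p a Bl mBr Bl'} → more-branches Bl Bl' →
              more-branches (Branch p (Some a Bl) mBr) (Branch p (Some a Bl') None)
    mb-Both : ∀ {p a Bl a' Br Bl' Br'} → more-branches Bl Bl' → more-branches Br Br' →
              more-branches (Branch p (Some a Bl) (Some a' Br)) (Branch p (Some a Bl') (Some a' Br'))

{-# OPTIONS --safe #-}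
-- The merge keeps every branch of its left argument, merging its continuation with the right
-- argument's one where both offer it; so one induction on the merge derivation shows that the
-- result has more branches than B1, an offer kept unchanged being covered by reflexivity of [>>].
module Submission where

open import Defs

module MergeMoreBranches (P E V A X : Set) where
  open SP P E V A X

  more-branches-refl : (B : Behaviour) → more-branches B B
  more-branches-refl End                            = mb-End
  more-branches-refl (Send p e a B)                 = mb-Send (more-branches-refl B)
  more-branches-refl (Recv p x a B)                 = mb-Recv (more-branches-refl B)
  more-branches-refl (Sel p l a B)                  = mb-Sel (more-branches-refl B)
  more-branches-refl (Branch p None None)           = mb-None
  more-branches-refl (Branch p None (Some a Br))    = mb-Right (more-branches-refl Br)
  more-branches-refl (Branch p (Some a Bl) None)    = mb-Left (more-branches-refl Bl)
  more-branches-refl (Branch p (Some a Bl) (Some a' Br)) =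
    mb-Both (more-branches-refl Bl) (more-branches-refl Br)
  more-branches-refl (If e B B') = mb-If (more-branches-refl B) (more-branches-refl B')
  more-branches-refl (Call x)    = mb-Call

  data more-offers : MBehaviour → MBehaviour → Set where
    mo-None : ∀ {mB} → more-offers mB None
    mo-Some : ∀ {a B B'} → more-branches B B' → more-offers (Some a B) (Some a B')

  more-branches-Branch : ∀ {p mBl mBr mBl' mBr'} →
    more-offers mBl mBl' → more-offers mBr mBr' →
    more-branches (Branch p mBl mBr) (Branch p mBl' mBr')
  more-branches-Branch mo-None     mo-None     = mb-None
  more-branches-Branch mo-None     (mo-Some r) = mb-Right r
  more-branches-Branch (mo-Some l) mo-None     = mb-Left l
  more-branches-Branch (mo-Some l) (mo-Some r) = mb-Both l r

  mutual
    merge-more-branchesˡ : ∀ {B1 B2 B} → merge B1 B2 B → more-branches B B1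
    merge-more-branchesˡ m-End            = mb-End
    merge-more-branchesˡ m-Call           = mb-Call
    merge-more-branchesˡ (m-Send m)       = mb-Send (merge-more-branchesˡ m)
    merge-more-branchesˡ (m-Recv m)       = mb-Recv (merge-more-branchesˡ m)
    merge-more-branchesˡ (m-Sel m)        = mb-Sel (merge-more-branchesˡ m)
    merge-more-branchesˡ (m-If m m')      = mb-If (merge-more-branchesˡ m) (merge-more-branchesˡ m')
    merge-more-branchesˡ (m-Branch ml mr) =
      more-branches-Branch (mmerge-more-offersˡ ml) (mmerge-more-offersˡ mr)

    mmerge-more-offersˡ : ∀ {mB1 mB2 mB} → mmerge mB1 mB2 mB → more-offers mB mB1
    mmerge-more-offersˡ mm-None           = mo-None
    mmerge-more-offersˡ (mm-Left {B = B}) = mo-Some (more-branches-refl B)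
    mmerge-more-offersˡ mm-Right          = mo-None
    mmerge-more-offersˡ (mm-Both m)       = mo-Some (merge-more-branchesˡ m)

mainTheorem12 : (P E V A X : Set) → (B1 B2 B : SP.Behaviour P E V A X) →
    SP.merge P E V A X B1 B2 B → SP.more-branches P E V A X B B1
mainTheorem12 P E V A X B1 B2 B = MergeMoreBranches.merge-more-branchesˡ P E V A X
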